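{- Let $T$ be a tree of order $t$ and let $\pi=(d_1,\dots,d_n)$ be a nonincreasing graphic sequence with $n\ge t$. If $d_{t-1}\ge t-1$, then $\pi$ is potentially $T$-graphic.
   Context: All graphs are finite and simple. A sequence of nonnegative integers $\pi=(d_1,\dots,d_n)$ is graphic if some graph of order $n$ has degree sequence $\pi$; such a graph is a realization of $\pi$. For a graph $H$, a graphic sequence $\pi$ is potentially $H$-graphic if some realization of $\pi$ contains $H$ as a subgraph. -}

module Defs where

open import Data.Nat using (ℕ; zero; suc; _≤_)
open import Data.Bool using (Bool; true; false; if_then_else_)
open import Data.Fin using (Fin; toℕ; inject₁; fromℕ)
import Data.Fin as F
open import Data.List using (List; tabulate)
open import Data.Nat.ListAction using (sum)
open import Data.Product using (Σ; ∃; _×_)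
open import Relation.Binary.PropositionalEquality using (_≡_)
open import Function.Definitions using (Injective)
open import Relation.Nullary using (¬_)

record Graph (n : ℕ) : Set where
  field
    adj    : Fin n → Fin n → Bool
    sym    : ∀ i j → adj i j ≡ adj j i
    irrefl : ∀ i → adj i i ≡ false
open Graph public

degree : ∀ {n} → Graph n → Fin n → ℕ
degree {n} G i = sum (tabulate {n = n} (λ j → if adj G i j then 1 else 0))

-- A sequence of length n (indexed by Fin n, 0-based: d (i) is d_{i+1}).
-- G is a realization of d if vertex i has degree d i.
IsRealization : ∀ {n} → (Fin n → ℕ) → Graph n → Set
IsRealization d G = ∀ i → degree G i ≡ d i

Graphic : ∀ {n} → (Fin n → ℕ) → Set
Graphic {n} d = Σ (Graph n) (IsRealization d)

NonIncreasing : ∀ {n} → (Fin n → ℕ) → Set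
NonIncreasing d = ∀ i j → toℕ i ≤ toℕ j → d j ≤ d i

SubgraphOf : ∀ {m n} → Graph m → Graph n → Set
SubgraphOf {m} {n} H G =
  Σ (Fin m → Fin n) λ f → Injective _≡_ _≡_ f ×
    (∀ i j → adj H i j ≡ true → adj G (f i) (f j) ≡ true)

PotentiallyGraphic : ∀ {m n} → Graph m → (Fin n → ℕ) → Set
PotentiallyGraphic {m} {n} H d =
  Σ (Graph n) λ G → IsRealization d G × SubgraphOf H G

data Walk {n} (G : Graph n) : Fin n → Fin n → Set where
  here : ∀ {u} → Walk G u u
  step : ∀ {u w v} → adj G u w ≡ true → Walk G w v → Walk G u v

Connected : ∀ {n} → Graph n → Set
Connected G = ∀ u v → Walk G u v

-- A cycle of length k+3: distinct vertices c 0, …, c (k+2) with consecutive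
-- vertices adjacent and the last adjacent to the first.
HasCycle : ∀ {n} → Graph n → Set
HasCycle {n} G =
  ∃ λ k → Σ (Fin (suc (suc (suc k))) → Fin n) λ c →
    Injective _≡_ _≡_ c ×
    (∀ (i : Fin (suc (suc k))) → adj G (c (inject₁ i)) (c (F.suc i)) ≡ true) ×
    adj G (c (fromℕ (suc (suc k)))) (c F.zero) ≡ true

Acyclic : ∀ {n} → Graph n → Set
Acyclic G = ¬ HasCycle G

IsTree : ∀ {t} → Graph t → Set
IsTree {t} T = 1 ≤ t × Connected T × Acyclic T

-- Write m = t ∸ 1; the hypotheses make each of the first m vertices have degree at least m.
-- Embed T one leaf at a time, keeping the image among the first m vertices as long as at
-- most m vertices are embedded.  To attach a leaf to the image x of its parent, note that
-- d x ≥ m gives x a neighbour z outside the current image.  If the new vertex must lie among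
-- the first m vertices and z does not, pick an unused vertex a there: either x ~ a already,
-- or d z ≤ d a yields some y ~ a with y ≁ z, and the 2-switch replacing xz, ay by xa, zy
-- keeps the degree sequence, creates xa, and leaves the image (which avoids z and a) intact.

module Submission where

open import Defs renaming (sym to adj-sym)
open import Data.Bool using (Bool; true; false; not; _∧_; _∨_; _xor_; if_then_else_)
import Data.Bool as Bool
open import Data.Bool.Properties
  using (∨-identityʳ; ∨-zeroʳ; ∨-comm; ∧-identityʳ; ∧-zeroʳ; ∧-comm; xor-identityʳ; T-≡)
open import Data.Empty using (⊥-elim)
open import Data.Fin using (Fin; zero; suc; toℕ; inject₁; fromℕ; fromℕ<; punchIn; punchOut)
open import Data.Fin.Properties
  using (_≟_; any?; toℕ-injective; toℕ-inject₁; toℕ-fromℕ; toℕ-fromℕ<; toℕ<n; injective⇒≤;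
         punchIn-injective; punchInᵢ≢i; punchIn-punchOut)
open import Data.List using (tabulate)
open import Data.Nat using (ℕ; zero; suc; _+_; _∸_; _≤_; _<_; _<ᵇ_; _<?_; z≤n; s≤s; s≤s⁻¹)
open import Data.Nat.ListAction using (sum)
open import Data.Nat.Properties
  using (module ≤-Reasoning; ≤-refl; ≤-reflexive; ≤-trans; <-irrefl; <⇒≤; <⇒≢; <⇒≱; ≮⇒≥;
         <-≤-trans; ≤-<-trans; +-mono-≤; +-monoʳ-≤; +-mono-<-≤; +-mono-≤-<; +-suc; +-identityʳ;
         n≤1+n; n<1+n; <ᵇ⇒<; anyUpTo?; +-commutativeSemigroup)
open import Algebra.Properties.CommutativeSemigroup +-commutativeSemigroup using (interchange)
open import Data.Product using (∃; ∃₂; _×_; _,_; proj₂)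
open import Data.Sum using (_⊎_; inj₁; inj₂)
open import Data.Vec.Functional using (insertAt)
open import Data.Vec.Functional.Properties using (insertAt-lookup; insertAt-punchIn)
open import Function using (_∘_)
open import Function.Bundles using (Equivalence)
open import Function.Definitions using (Injective)
open import Relation.Binary.PropositionalEquality
open import Relation.Nullary using (Dec; ¬_; yes; no; does; _×-dec_)
open import Relation.Nullary.Decidable using (dec-true; dec-false; ¬?)

private
  variable
    n s t : ℕ

-- Counting

-- Written with if_then_else_ so that degree G v is definitionally count (adj G v).
ι : Bool → ℕ
ι b = if b then 1 else 0

count : (Fin n → Bool) → ℕ
count P = sum (tabulate (λ j → ι (P j)))

_≡ᵇ_ : Fin n → Fin n → Bool
i ≡ᵇ j = does (i ≟ j)

_⊆_ : (P Q : Fin n → Bool) → Set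
P ⊆ Q = ∀ j → P j ≡ true → Q j ≡ true

count-cong : {P Q : Fin n → Bool} → (∀ j → P j ≡ Q j) → count P ≡ count Q
count-cong {zero}  eq = refl
count-cong {suc n} eq = cong₂ _+_ (cong ι (eq zero)) (count-cong (λ j → eq (suc j)))

count-false : count {n} (λ _ → false) ≡ 0
count-false {zero}  = refl
count-false {suc n} = count-false {n}

ι-mono : {a b : Bool} → (a ≡ true → b ≡ true) → ι a ≤ ι b
ι-mono {false} _   = z≤n
ι-mono {true}  a⇒b rewrite a⇒b refl = ≤-refl

count-mono : {P Q : Fin n → Bool} → P ⊆ Q → count P ≤ count Q
count-mono {zero}  P⊆Q = z≤n
count-mono {suc n} P⊆Q = +-mono-≤ (ι-mono (P⊆Q zero)) (count-mono (λ j → P⊆Q (suc j)))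

count-mono-< : {P Q : Fin n → Bool} → P ⊆ Q → (x : Fin n) →
               Q x ≡ true → P x ≡ false → count P < count Q
count-mono-< {suc n} P⊆Q zero    Qx Px rewrite Qx | Px =
  +-mono-<-≤ (s≤s z≤n) (count-mono (λ j → P⊆Q (suc j)))
count-mono-< {suc n} P⊆Q (suc x) Qx Px =
  +-mono-≤-< (ι-mono (P⊆Q zero)) (count-mono-< (λ j → P⊆Q (suc j)) x Qx Px)

ι-∨ : (a b : Bool) → ι (a ∨ b) ≤ ι a + ι b
ι-∨ true  b = s≤s z≤n
ι-∨ false b = ≤-refl

count-∨ : (P Q : Fin n → Bool) → count (λ j → P j ∨ Q j) ≤ count P + count Q
count-∨ {zero}  P Q = z≤n
count-∨ {suc n} P Q = begin
  ι (P zero ∨ Q zero) + count (λ j → P (suc j) ∨ Q (suc j))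
    ≤⟨ +-mono-≤ (ι-∨ (P zero) (Q zero)) (count-∨ (λ j → P (suc j)) (λ j → Q (suc j))) ⟩
  (ι (P zero) + ι (Q zero)) + (count (λ j → P (suc j)) + count (λ j → Q (suc j)))
    ≡⟨ interchange (ι (P zero)) (ι (Q zero)) _ _ ⟩
  count P + count Q ∎
  where open ≤-Reasoning

count-insert : (P : Fin n → Bool) (c : Fin n) → P c ≡ false →
               count (λ j → P j ∨ j ≡ᵇ c) ≡ suc (count P)
count-insert {suc n} P zero Pc rewrite Pc =
  cong suc (count-cong (λ j → ∨-identityʳ (P (suc j))))
count-insert {suc n} P (suc c) Pc = begin
  ι (P zero ∨ false) + count (λ j → P (suc j) ∨ j ≡ᵇ c)
    ≡⟨ cong₂ _+_ (cong ι (∨-identityʳ (P zero))) (count-insert (λ j → P (suc j)) c Pc) ⟩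
  ι (P zero) + suc (count (λ j → P (suc j)))
    ≡⟨ +-suc (ι (P zero)) _ ⟩
  suc (count P) ∎
  where open ≡-Reasoning

_∖_ : (Fin n → Bool) → Fin n → Fin n → Bool
(P ∖ c) j = P j ∧ not (j ≡ᵇ c)

∖-restore : (P : Fin n → Bool) {c : Fin n} → P c ≡ true → ∀ j → P j ≡ (P ∖ c) j ∨ j ≡ᵇ c
∖-restore P {c} Pc j with j ≟ c
... | yes refl = sym (trans (∨-zeroʳ _) (sym Pc))
... | no  _    = sym (trans (∨-identityʳ _) (∧-identityʳ (P j)))

∖-absent : (P : Fin n → Bool) {c : Fin n} → P c ≡ false → ∀ j → (P ∖ c) j ≡ P j
∖-absent P {c} Pc j with j ≟ c
... | yes refl = trans (∧-zeroʳ (P c)) (sym Pc)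
... | no  _    = ∧-identityʳ (P j)

∖-self : (P : Fin n → Bool) (c : Fin n) → (P ∖ c) c ≡ false
∖-self P c rewrite dec-true (c ≟ c) refl = ∧-zeroʳ (P c)

count-split : (P : Fin n → Bool) (c : Fin n) → count P ≡ ι (P c) + count (P ∖ c)
count-split P c with P c in Pc
... | true  = trans (count-cong (∖-restore P Pc)) (count-insert (P ∖ c) c (∖-self P c))
... | false = sym (count-cong (∖-absent P Pc))

toggle-pointwise : (P : Fin n → Bool) {g l : Fin n} → P g ≡ false → P l ≡ true →
                   ∀ j → P j xor (j ≡ᵇ g ∨ j ≡ᵇ l) ≡ (P ∖ l) j ∨ j ≡ᵇ g
toggle-pointwise P {g} {l} Pg Pl j with j ≟ g | j ≟ l
... | yes refl | yes refl with () ← trans (sym Pl) Pg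
... | yes refl | no  _    rewrite Pg = refl
... | no  _    | yes refl rewrite Pl = refl
... | no  _    | no  _    = sym (trans (∨-identityʳ _) (trans (∧-identityʳ (P j)) (sym (xor-identityʳ (P j)))))

count-toggle′ : (P : Fin n → Bool) {g l : Fin n} → P g ≡ false → P l ≡ true →
                count (λ j → P j xor (j ≡ᵇ g ∨ j ≡ᵇ l)) ≡ count P
count-toggle′ P {g} {l} Pg Pl = begin
  count (λ j → P j xor (j ≡ᵇ g ∨ j ≡ᵇ l)) ≡⟨ count-cong (toggle-pointwise P Pg Pl) ⟩
  count (λ j → (P ∖ l) j ∨ j ≡ᵇ g)        ≡⟨ count-insert (P ∖ l) g (cong (_∧ _) Pg) ⟩
  suc (count (P ∖ l))                      ≡⟨ cong (λ b → ι b + count (P ∖ l)) Pl ⟨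
  ι (P l) + count (P ∖ l)                  ≡⟨ count-split P l ⟨
  count P                                  ∎
  where open ≡-Reasoning

count-toggle : (P : Fin n → Bool) {g l : Fin n} → P g ≡ not (P l) →
               count (λ j → P j xor (j ≡ᵇ g ∨ j ≡ᵇ l)) ≡ count P
count-toggle P {g} {l} Pg with P l in Pl
... | true  = count-toggle′ P Pg Pl
... | false = trans (count-cong (λ j → cong (P j xor_) (∨-comm (j ≡ᵇ g) (j ≡ᵇ l)))) (count-toggle′ P Pl Pg)

count-<ᵇ : {m : ℕ} → m ≤ n → count {n} (λ j → toℕ j <ᵇ m) ≡ m
count-<ᵇ {zero}  {zero}  _       = refl
count-<ᵇ {suc n} {zero}  _       = count-false {suc n}
count-<ᵇ {suc n} {suc m} (s≤s p) = cong suc (count-<ᵇ p)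

image : (Fin s → Fin n) → Fin n → Bool
image f j = does (any? (λ i → j ≟ f i))

∉-image : (f : Fin s → Fin n) {j : Fin n} → image f j ≡ false → ∀ i → j ≢ f i
∉-image f {j} notIn i j≡fi with () ← trans (sym (dec-true (any? (λ k → j ≟ f k)) (i , j≡fi))) notIn

count-image : (f : Fin s → Fin n) → count (image f) ≤ s
count-image {zero}  {n} f = ≤-reflexive (count-false {n})
count-image {suc s} {n} f = begin
  count (image f)
    ≤⟨ count-∨ (_≡ᵇ f zero) (image (λ i → f (suc i))) ⟩
  count (_≡ᵇ f zero) + count (image (λ i → f (suc i)))
    ≤⟨ +-monoʳ-≤ (count (_≡ᵇ f zero)) (count-image (λ i → f (suc i))) ⟩
  count (_≡ᵇ f zero) + s
    ≡⟨ cong (_+ s) (count-insert (λ _ → false) (f zero) refl) ⟩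
  suc (count {n} (λ _ → false)) + s
    ≡⟨ cong (λ k → suc k + s) (count-false {n}) ⟩
  suc s ∎
  where open ≤-Reasoning

escape : (P Q : Fin n → Bool) → P ⊆ Q ⊎ ∃ λ j → P j ≡ true × Q j ≡ false
escape P Q with any? (λ j → (P j Bool.≟ true) ×-dec (Q j Bool.≟ false))
... | yes witness = inj₂ witness
... | no  none    = inj₁ included
  where
  included : P ⊆ Q
  included j Pj with Q j in Qj
  ... | true  = refl
  ... | false = ⊥-elim (none (j , Pj , Qj))

fresh-neighbour : (G : Graph n) (f : Fin s → Fin n) (k : Fin s) → s ≤ degree G (f k) →
                  ∃ λ z → adj G (f k) z ≡ true × ∀ i → z ≢ f i
fresh-neighbour {s = s} G f k s≤deg
  with escape (λ j → adj G (f k) j ∨ j ≡ᵇ f k) (image f)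
... | inj₁ closed⊆im = ⊥-elim (<-irrefl refl (begin
  suc (degree G (f k))                   ≡⟨ count-insert (adj G (f k)) (f k) (irrefl G (f k)) ⟨
  count (λ j → adj G (f k) j ∨ j ≡ᵇ f k)  ≤⟨ count-mono closed⊆im ⟩
  count (image f)                        ≤⟨ count-image f ⟩
  s                                      ≤⟨ s≤deg ⟩
  degree G (f k)                         ∎))
  where open ≤-Reasoning
... | inj₂ (z , closed , z∉) = z , neighbour , ∉-image f z∉
  where
  neighbour : adj G (f k) z ≡ true
  neighbour rewrite dec-false (z ≟ f k) (∉-image f z∉ k) = trans (sym (∨-identityʳ _)) closed

fresh-below : {m : ℕ} (f : Fin s → Fin n) → s < m → m ≤ n → ∃ λ a → toℕ a < m × ∀ i → a ≢ f i
fresh-below {s = s} {n = n} {m = m} f s<m m≤n with escape (λ j → toℕ j <ᵇ m) (image f)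
... | inj₁ below⊆im = ⊥-elim (<⇒≱ s<m (begin
  m                            ≡⟨ count-<ᵇ m≤n ⟨
  count {n} (λ j → toℕ j <ᵇ m) ≤⟨ count-mono below⊆im ⟩
  count (image f)              ≤⟨ count-image f ⟩
  s                            ∎))
  where open ≤-Reasoning
... | inj₂ (a , a<m , a∉) = a , <ᵇ⇒< (toℕ a) m (Equivalence.from T-≡ a<m) , ∉-image f a∉

switch-partner : (G : Graph n) {x z a : Fin n} → x ≢ a → adj G x z ≡ true → adj G x a ≡ false →
                 degree G z ≤ degree G a → ∃ λ y → adj G a y ≡ true × adj G z y ≡ false × y ≢ z
switch-partner G {x} {z} {a} x≢a x~z ¬x~a deg≤ with escape (adj G a ∖ z) (adj G z ∖ a)
... | inj₁ Na⊆Nz = ⊥-elim (<⇒≱ (begin-strict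
  degree G a                          ≡⟨ count-split (adj G a) z ⟩
  ι (adj G a z) + count (adj G a ∖ z)  <⟨ +-mono-≤-< (≤-reflexive (cong ι (adj-sym G a z)))
                                          (count-mono-< Na⊆Nz x x∈Nz x∉Na) ⟩
  ι (adj G z a) + count (adj G z ∖ a)  ≡⟨ count-split (adj G z) a ⟨
  degree G z                          ∎) deg≤)
  where
  open ≤-Reasoning
  x∈Nz : (adj G z ∖ a) x ≡ true
  x∈Nz rewrite adj-sym G z x | x~z | dec-false (x ≟ a) x≢a = refl
  x∉Na : (adj G a ∖ z) x ≡ false
  x∉Na rewrite adj-sym G a x | ¬x~a = refl
... | inj₂ (y , y∈Na , y∉Nz) with y ≟ z | y ≟ a
...   | yes refl | _        rewrite ∧-zeroʳ (adj G a y) with () ← y∈Na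
...   | no  _    | yes refl rewrite irrefl G y with () ← y∈Na
...   | no  y≢z  | no  _    =
  y , trans (sym (∧-identityʳ _)) y∈Na , trans (sym (∧-identityʳ _)) y∉Nz , y≢z

-- The 2-switch

edge : Fin n → Fin n → Fin n → Fin n → Bool
edge p q u v = (u ≡ᵇ p ∧ v ≡ᵇ q) ∨ (u ≡ᵇ q ∧ v ≡ᵇ p)

module _ {p q : Fin n} where

  edge-sym : ∀ u v → edge p q u v ≡ edge p q v u
  edge-sym u v = trans (∨-comm (u ≡ᵇ p ∧ v ≡ᵇ q) _)
                       (cong₂ _∨_ (∧-comm (u ≡ᵇ q) (v ≡ᵇ p)) (∧-comm (u ≡ᵇ p) (v ≡ᵇ q)))

  edge-irrefl : p ≢ q → ∀ u → edge p q u u ≡ false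
  edge-irrefl p≢q u with u ≟ p | u ≟ q
  ... | yes refl | yes refl with () ← p≢q refl
  ... | yes _    | no  _    = refl
  ... | no  _    | yes _    = refl
  ... | no  _    | no  _    = refl

  edge-fromˡ : p ≢ q → ∀ v → edge p q p v ≡ v ≡ᵇ q
  edge-fromˡ p≢q v rewrite dec-true (p ≟ p) refl | dec-false (p ≟ q) p≢q = ∨-identityʳ (v ≡ᵇ q)

  edge-fromʳ : p ≢ q → ∀ v → edge p q q v ≡ v ≡ᵇ p
  edge-fromʳ p≢q v rewrite dec-true (q ≟ q) refl | dec-false (q ≟ p) (p≢q ∘ sym) = refl

  edge-off : ∀ {u} → u ≢ p → u ≢ q → ∀ v → edge p q u v ≡ false
  edge-off u≢p u≢q v rewrite dec-false (_ ≟ p) u≢p | dec-false (_ ≟ q) u≢q = refl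

  edge-avoidˡ : ∀ {u v} → u ≢ p → v ≢ p → edge p q u v ≡ false
  edge-avoidˡ {u} {v} u≢p v≢p rewrite dec-false (u ≟ p) u≢p | dec-false (v ≟ p) v≢p = ∧-zeroʳ (u ≡ᵇ q)

  edge-avoidʳ : ∀ {u v} → u ≢ q → v ≢ q → edge p q u v ≡ false
  edge-avoidʳ {u} {v} u≢q v≢q rewrite dec-false (u ≟ q) u≢q | dec-false (v ≟ q) v≢q =
    trans (∨-identityʳ _) (∧-zeroʳ (u ≡ᵇ p))

-- Replaces the edges xz, ya by xa, zy, i.e. toggles adjacency along the 4-cycle x z y a.
module TwoSwitch (G : Graph n) {x z y a : Fin n}
  (x≢z : x ≢ z) (x≢y : x ≢ y) (x≢a : x ≢ a) (z≢y : z ≢ y) (z≢a : z ≢ a) (y≢a : y ≢ a)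
  (x~z : adj G x z ≡ true) (y~a : adj G y a ≡ true) (¬x~a : adj G x a ≡ false) (¬z~y : adj G z y ≡ false)
  where

  cycle : Fin n → Fin n → Bool
  cycle u v = edge x z u v ∨ edge z y u v ∨ edge y a u v ∨ edge a x u v

  switched : Graph n
  switched = record
    { adj    = λ u v → adj G u v xor cycle u v
    ; sym    = λ u v → cong₂ _xor_ (adj-sym G u v) (cycle-sym u v)
    ; irrefl = λ u → cong₂ _xor_ (irrefl G u) (cycle-irrefl u)
    }
    where
    cycle-sym : ∀ u v → cycle u v ≡ cycle v u
    cycle-sym u v rewrite edge-sym {p = x} {z} u v | edge-sym {p = z} {y} u v
                        | edge-sym {p = y} {a} u v | edge-sym {p = a} {x} u v = refl
    cycle-irrefl : ∀ u → cycle u u ≡ false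
    cycle-irrefl u rewrite edge-irrefl x≢z u | edge-irrefl z≢y u
                         | edge-irrefl y≢a u | edge-irrefl (x≢a ∘ sym) u = refl

  cycle-at-x : ∀ j → cycle x j ≡ (j ≡ᵇ z ∨ j ≡ᵇ a)
  cycle-at-x j rewrite edge-fromˡ x≢z j | edge-off x≢z x≢y j | edge-off x≢y x≢a j
                     | edge-fromʳ (x≢a ∘ sym) j = refl

  cycle-at-z : ∀ j → cycle z j ≡ (j ≡ᵇ x ∨ j ≡ᵇ y)
  cycle-at-z j rewrite edge-fromʳ x≢z j | edge-fromˡ z≢y j | edge-off z≢y z≢a j
                     | edge-off z≢a (x≢z ∘ sym) j = cong (j ≡ᵇ x ∨_) (∨-identityʳ (j ≡ᵇ y))

  cycle-at-y : ∀ j → cycle y j ≡ (j ≡ᵇ z ∨ j ≡ᵇ a)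
  cycle-at-y j rewrite edge-off (x≢y ∘ sym) (z≢y ∘ sym) j | edge-fromʳ z≢y j | edge-fromˡ y≢a j
                     | edge-off y≢a (x≢y ∘ sym) j = cong (j ≡ᵇ z ∨_) (∨-identityʳ (j ≡ᵇ a))

  cycle-at-a : ∀ j → cycle a j ≡ (j ≡ᵇ y ∨ j ≡ᵇ x)
  cycle-at-a j rewrite edge-off (x≢a ∘ sym) (z≢a ∘ sym) j | edge-off (z≢a ∘ sym) (y≢a ∘ sym) j
                     | edge-fromʳ y≢a j | edge-fromˡ (x≢a ∘ sym) j = refl

  cycle-elsewhere : ∀ {u} → u ≢ x → u ≢ z → u ≢ y → u ≢ a → ∀ j → cycle u j ≡ false
  cycle-elsewhere u≢x u≢z u≢y u≢a j
    rewrite edge-off u≢x u≢z j | edge-off u≢z u≢y j | edge-off u≢y u≢a j | edge-off u≢a u≢x j = refl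

  cycle-degree : ∀ {u g l} → (∀ j → cycle u j ≡ (j ≡ᵇ g ∨ j ≡ᵇ l)) → adj G u g ≡ not (adj G u l) →
                 degree switched u ≡ degree G u
  cycle-degree {u} row opposite =
    trans (count-cong (λ j → cong (adj G u j xor_) (row j))) (count-toggle (adj G u) opposite)

  degree-switched : ∀ u → degree switched u ≡ degree G u
  degree-switched u = by-cases u (u ≟ x) (u ≟ z) (u ≟ y) (u ≟ a)
    where
    by-cases : ∀ u → Dec (u ≡ x) → Dec (u ≡ z) → Dec (u ≡ y) → Dec (u ≡ a) →
               degree switched u ≡ degree G u
    by-cases _ (yes refl) _ _ _ =
      cycle-degree cycle-at-x (trans x~z (cong not (sym ¬x~a)))
    by-cases _ (no _) (yes refl) _ _ =
      cycle-degree cycle-at-z (trans (adj-sym G z x) (trans x~z (cong not (sym ¬z~y))))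
    by-cases _ (no _) (no _) (yes refl) _ =
      cycle-degree cycle-at-y (trans (adj-sym G y z) (trans ¬z~y (cong not (sym y~a))))
    by-cases _ (no _) (no _) (no _) (yes refl) =
      cycle-degree cycle-at-a (trans (adj-sym G a y) (trans y~a (cong not (sym (trans (adj-sym G a x) ¬x~a)))))
    by-cases u (no u≢x) (no u≢z) (no u≢y) (no u≢a) =
      count-cong (λ j → trans (cong (adj G u j xor_) (cycle-elsewhere u≢x u≢z u≢y u≢a j)) (xor-identityʳ _))

  switched-adds : adj switched x a ≡ true
  switched-adds rewrite ¬x~a | cycle-at-x a | dec-true (a ≟ a) refl = ∨-zeroʳ (a ≡ᵇ z)

  -- Every edge of the 4-cycle has an endpoint in {z, a}.
  switched-keeps : ∀ {u v} → adj G u v ≡ true → u ≢ z → v ≢ z → u ≢ a → v ≢ a →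
                   adj switched u v ≡ true
  switched-keeps uv u≢z v≢z u≢a v≢a
    rewrite edge-avoidʳ {p = x} u≢z v≢z | edge-avoidˡ {q = y} u≢z v≢z
          | edge-avoidʳ {p = y} u≢a v≢a | edge-avoidˡ {q = x} u≢a v≢a = trans (xor-identityʳ _) uv

-- Leaves of trees

IsLeaf : Graph t → Fin t → Fin t → Set
IsLeaf T ℓ p = adj T ℓ p ≡ true × (∀ w → adj T ℓ w ≡ true → w ≡ p)

module Paths (T : Graph t) where

  -- The vertices are vertex 0, …, vertex (k ∸ 1); paths grow by prepending at first p.
  record Path (k : ℕ) : Set where
    field
      vertex   : ℕ → Fin t
      adjacent : ∀ j → suc j < k → adj T (vertex j) (vertex (suc j)) ≡ true
      distinct : ∀ i j → i < k → j < k → vertex i ≡ vertex j → i ≡ j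
  open Path public

  first : ∀ {k} → Path k → Fin t
  first p = vertex p 0

  _∈ₚ_ : ∀ {k} → Fin t → Path k → Set
  _∈ₚ_ {k} w p = ∃ λ j → j < k × vertex p j ≡ w

  _∈ₚ?_ : ∀ {k} (w : Fin t) (p : Path k) → Dec (w ∈ₚ p)
  _∈ₚ?_ {k} w p = anyUpTo? (λ j → vertex p j ≟ w) k

  path-length : ∀ {k} → Path k → k ≤ t
  path-length {k} p = injective⇒≤ {f = λ (i : Fin k) → vertex p (toℕ i)}
    (λ e → toℕ-injective (distinct p _ _ (toℕ<n _) (toℕ<n _) e))

  trivial : Fin t → Path 1
  trivial v = record
    { vertex   = λ _ → v
    ; adjacent = λ { _ (s≤s ()) }
    ; distinct = λ { zero zero _ _ _ → refl ; (suc _) _ (s≤s ()) _ _ ; _ (suc _) _ (s≤s ()) _ }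
    }

  prepend : ∀ {k} (p : Path k) (w : Fin t) → adj T w (first p) ≡ true → ¬ w ∈ₚ p → Path (suc k)
  prepend {k} p w w~p w∉p = record { vertex = vertex′ ; adjacent = adjacent′ ; distinct = distinct′ }
    where
    vertex′ : ℕ → Fin t
    vertex′ zero    = w
    vertex′ (suc j) = vertex p j
    adjacent′ : ∀ j → suc j < suc k → adj T (vertex′ j) (vertex′ (suc j)) ≡ true
    adjacent′ zero    _         = w~p
    adjacent′ (suc j) (s≤s j<k) = adjacent p j j<k
    distinct′ : ∀ i j → i < suc k → j < suc k → vertex′ i ≡ vertex′ j → i ≡ j
    distinct′ zero    zero    _         _         _ = refl
    distinct′ zero    (suc j) _         (s≤s j<k) e = ⊥-elim (w∉p (j , j<k , sym e))
    distinct′ (suc i) zero    (s≤s i<k) _         e = ⊥-elim (w∉p (i , i<k , e))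
    distinct′ (suc i) (suc j) (s≤s i<k) (s≤s j<k) e = cong suc (distinct p i j i<k j<k e)

  record MaximalPath : Set where
    field
      length : ℕ
      path   : Path length
      closed : ∀ w → adj T (first path) w ≡ true → w ∈ₚ path
  open MaximalPath public

  maximal-path : ∀ fuel {k} → t < k + fuel → Path k → MaximalPath
  maximal-path zero {k} t<k p = ⊥-elim (<⇒≱ (subst (t <_) (+-identityʳ k) t<k) (path-length p))
  maximal-path (suc fuel) {k} t<k p
    with any? (λ w → (adj T (first p) w Bool.≟ true) ×-dec ¬? (w ∈ₚ? p))
  ... | yes (w , p~w , w∉p) =
    maximal-path fuel (subst (t <_) (+-suc k fuel) t<k) (prepend p w (trans (adj-sym T w _) p~w) w∉p)
  ... | no none = record { path = p ; closed = neighbours-on-p }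
    where
    neighbours-on-p : ∀ w → adj T (first p) w ≡ true → w ∈ₚ p
    neighbours-on-p w p~w with w ∈ₚ? p
    ... | yes w∈p = w∈p
    ... | no  w∉p = ⊥-elim (none (w , p~w , w∉p))

  path-cycle : ∀ {k} (p : Path k) K → suc (suc (suc K)) ≤ k →
               adj T (first p) (vertex p (suc (suc K))) ≡ true → HasCycle T
  path-cycle p K K+3≤k closing = K , c , c-injective , c-adjacent , c-closing
    where
    c : Fin (suc (suc (suc K))) → Fin t
    c m = vertex p (toℕ m)
    c-injective : ∀ {m m′} → c m ≡ c m′ → m ≡ m′
    c-injective e = toℕ-injective
      (distinct p _ _ (<-≤-trans (toℕ<n _) K+3≤k) (<-≤-trans (toℕ<n _) K+3≤k) e)
    c-adjacent : ∀ (i : Fin (suc (suc K))) → adj T (c (inject₁ i)) (c (suc i)) ≡ true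
    c-adjacent i rewrite toℕ-inject₁ i = adjacent p (toℕ i) (<-≤-trans (s≤s (toℕ<n i)) K+3≤k)
    c-closing : adj T (c (fromℕ (suc (suc K)))) (c zero) ≡ true
    c-closing rewrite toℕ-fromℕ (suc (suc K)) = trans (adj-sym T _ _) closing

  maximal-path-leaf : Acyclic T → (mp : MaximalPath) → ∃ (λ w → adj T (first (path mp)) w ≡ true) →
                      IsLeaf T (first (path mp)) (vertex (path mp) 1)
  maximal-path-leaf acyclic mp (w , v₀~w) =
    subst (λ w → adj T v₀ w ≡ true) (only-neighbour w v₀~w) v₀~w , only-neighbour
    where
    v₀ = first (path mp)
    only-neighbour : ∀ w → adj T v₀ w ≡ true → w ≡ vertex (path mp) 1
    only-neighbour w v₀~w with closed mp w v₀~w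
    ... | zero , _ , refl with () ← trans (sym v₀~w) (irrefl T v₀)
    ... | suc zero , _ , refl = refl
    ... | suc (suc K) , K+3≤k , refl = ⊥-elim (acyclic (path-cycle (path mp) K K+3≤k v₀~w))

walk-neighbour : {T : Graph t} {u v : Fin t} → Walk T u v → u ≢ v → ∃ λ w → adj T u w ≡ true
walk-neighbour here            u≢u = ⊥-elim (u≢u refl)
walk-neighbour (step u~w _)    _   = _ , u~w

some-other : {u v : Fin t} → u ≢ v → (w : Fin t) → ∃ λ o → w ≢ o
some-other {u = u} {v} u≢v w with w ≟ u
... | yes refl = v , u≢v
... | no  w≢u  = u , w≢u

has-leaf : (T : Graph t) → Connected T → Acyclic T → {u v : Fin t} → u ≢ v → ∃₂ λ ℓ p → IsLeaf T ℓ p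
has-leaf {t} T connected acyclic {u} u≢v =
  let mp = maximal-path t (n<1+n t) (trivial u)
      v₀ = first (path mp)
      (o , v₀≢o) = some-other u≢v v₀
  in _ , _ , maximal-path-leaf acyclic mp (walk-neighbour (connected v₀ o) v₀≢o)
  where open Paths T

deleteVertex : ∀ {s} → Graph (suc s) → Fin (suc s) → Graph s
deleteVertex T ℓ = record
  { adj    = λ i j → adj T (punchIn ℓ i) (punchIn ℓ j)
  ; sym    = λ i j → adj-sym T (punchIn ℓ i) (punchIn ℓ j)
  ; irrefl = λ i → irrefl T (punchIn ℓ i)
  }

deleteVertex-acyclic : ∀ {s} (T : Graph (suc s)) (ℓ : Fin (suc s)) → Acyclic T → Acyclic (deleteVertex T ℓ)
deleteVertex-acyclic T ℓ acyclic (K , c , c-injective , c-adjacent , c-closing) =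
  acyclic (K , (λ m → punchIn ℓ (c m)) , (λ e → c-injective (punchIn-injective ℓ _ _ e)) , c-adjacent , c-closing)

module _ {s} {T : Graph (suc s)} {ℓ p : Fin (suc s)} (leaf : IsLeaf T ℓ p) where

  -- A walk that enters the leaf ℓ comes from p and must return to p, so that detour can be cut out.
  avoid-leaf : ∀ {u v} → Walk T u v → (i j : Fin s) → u ≡ punchIn ℓ i → v ≡ punchIn ℓ j →
               Walk (deleteVertex T ℓ) i j
  avoid-leaf here i j refl v≡ = subst (Walk _ i) (punchIn-injective ℓ i j v≡) here
  avoid-leaf (step {w = w} u~w rest) i j refl v≡ with ℓ ≟ w
  ... | no ℓ≢w = step (subst (λ w′ → adj T (punchIn ℓ i) w′ ≡ true) (sym (punchIn-punchOut ℓ≢w)) u~w)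
                      (avoid-leaf rest (punchOut ℓ≢w) j (sym (punchIn-punchOut ℓ≢w)) v≡)
  ... | yes refl with rest
  ...   | here = ⊥-elim (punchInᵢ≢i ℓ j (sym v≡))
  ...   | step ℓ~w′ rest′ =
    avoid-leaf rest′ i j (trans (proj₂ leaf _ ℓ~w′) (sym (proj₂ leaf _ (trans (adj-sym T ℓ _) u~w)))) v≡

  deleteVertex-connected : Connected T → Connected (deleteVertex T ℓ)
  deleteVertex-connected connected i j = avoid-leaf (connected (punchIn ℓ i) (punchIn ℓ j)) i j refl refl

tree-leaf : ∀ {s} (T : Graph (suc (suc s))) → IsTree T →
            ∃₂ λ ℓ p → IsLeaf T ℓ p × IsTree (deleteVertex T ℓ)
tree-leaf T (_ , connected , acyclic) with has-leaf T connected acyclic {zero} {suc zero} (λ ())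
... | ℓ , p , leaf = ℓ , p , leaf , s≤s z≤n , deleteVertex-connected leaf connected , deleteVertex-acyclic T ℓ acyclic

-- Embedding trees

module TreeEmbedding {n m : ℕ} (d : Fin n → ℕ) (nonIncreasing : NonIncreasing d)
  (high : ∀ i → toℕ i < m → m ≤ d i) (m<n : m < n) where

  record Attachment {s} (G : Graph n) (f : Fin s → Fin n) (x : Fin n) : Set where
    field
      G′        : Graph n
      realizes  : IsRealization d G′
      keeps     : ∀ i j → adj G (f i) (f j) ≡ true → adj G′ (f i) (f j) ≡ true
      w         : Fin n
      x~w       : adj G′ x w ≡ true
      w-new     : ∀ i → w ≢ f i
      w-initial : s < m → toℕ w < m

  module _ {s} (G : Graph n) (realizes : IsRealization d G) (f : Fin s → Fin n) where

    attach-directly : ∀ {x w} → adj G x w ≡ true → (∀ i → w ≢ f i) → (s < m → toℕ w < m) →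
                      Attachment G f x
    attach-directly {w = w} x~w w-new w-initial = record
      { G′ = G ; realizes = realizes ; keeps = λ _ _ e → e
      ; w = w ; x~w = x~w ; w-new = w-new ; w-initial = w-initial }

    attach-by-switch : ∀ (k : Fin s) {z a y} → adj G (f k) z ≡ true → adj G (f k) a ≡ false →
                       adj G a y ≡ true → adj G z y ≡ false → y ≢ z →
                       (∀ i → z ≢ f i) → (∀ i → a ≢ f i) → toℕ a < m → m ≤ toℕ z →
                       Attachment G f (f k)
    attach-by-switch k {z} {a} {y} x~z ¬x~a a~y ¬z~y y≢z z-new a-new a<m m≤z = record
      { G′ = switched ; realizes = λ v → trans (degree-switched v) (realizes v)
      ; keeps = λ i j e → switched-keeps e (z-new i ∘ sym) (z-new j ∘ sym) (a-new i ∘ sym) (a-new j ∘ sym)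
      ; w = a ; x~w = switched-adds ; w-new = a-new ; w-initial = λ _ → a<m }
      where
      x≢z : f k ≢ z
      x≢z refl with () ← trans (sym x~z) (irrefl G (f k))
      x≢y : f k ≢ y
      x≢y refl with () ← trans (sym a~y) (trans (adj-sym G a (f k)) ¬x~a)
      z≢a : z ≢ a
      z≢a refl = <⇒≢ (<-≤-trans a<m m≤z) refl
      y≢a : y ≢ a
      y≢a refl with () ← trans (sym a~y) (irrefl G y)
      open TwoSwitch G x≢z x≢y (a-new k ∘ sym) (y≢z ∘ sym) z≢a y≢a
        x~z (trans (adj-sym G y a) a~y) ¬x~a ¬z~y

    attach : (k : Fin s) → s ≤ m → toℕ (f k) < m → Attachment G f (f k)
    attach k s≤m x<m with fresh-neighbour G f k s≤deg
      where
      s≤deg : s ≤ degree G (f k)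
      s≤deg rewrite realizes (f k) = ≤-trans s≤m (high (f k) x<m)
    ... | z , x~z , z-new with s <? m | toℕ z <? m
    ...   | no  s≮m | _       = attach-directly x~z z-new (⊥-elim ∘ s≮m)
    ...   | yes _   | yes z<m = attach-directly x~z z-new (λ _ → z<m)
    ...   | yes s<m | no  z≮m with fresh-below f s<m (<⇒≤ m<n)
    ...     | a , a<m , a-new with adj G (f k) a in x~a
    ...       | true  = attach-directly x~a a-new (λ _ → a<m)
    ...       | false with switch-partner G (a-new k ∘ sym) x~z x~a deg-z≤deg-a
      where
      deg-z≤deg-a : degree G z ≤ degree G a
      deg-z≤deg-a rewrite realizes z | realizes a = nonIncreasing a z (<⇒≤ (<-≤-trans a<m (≮⇒≥ z≮m)))
    ...         | y , a~y , ¬z~y , y≢z = attach-by-switch k x~z x~a a~y ¬z~y y≢z z-new a-new a<m (≮⇒≥ z≮m)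

  record Embedding {s} (H : Graph s) : Set where
    field
      G         : Graph n
      realizes  : IsRealization d G
      f         : Fin s → Fin n
      injective : Injective _≡_ _≡_ f
      preserves : ∀ i j → adj H i j ≡ true → adj G (f i) (f j) ≡ true
      -- the first m vertices all have degree at least m (hypothesis high)
      initial   : s ≤ m → ∀ i → toℕ (f i) < m

  ≡-or-punchIn : ∀ {s} (ℓ i : Fin (suc s)) → i ≡ ℓ ⊎ ∃ λ k → i ≡ punchIn ℓ k
  ≡-or-punchIn ℓ i with ℓ ≟ i
  ... | yes ℓ≡i = inj₁ (sym ℓ≡i)
  ... | no  ℓ≢i = inj₂ (punchOut ℓ≢i , sym (punchIn-punchOut ℓ≢i))

  extend : ∀ {s} (H : Graph (suc (suc s))) {ℓ p} → IsLeaf H ℓ p → suc s ≤ m →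
           Embedding (deleteVertex H ℓ) → Embedding H
  extend {s} H {ℓ} {p} (ℓ~p , only-p) s+1≤m E = record
    { G = G′ ; realizes = realizes′ ; f = f′ ; injective = injective′ ; preserves = preserves′ ; initial = initial′ }
    where
    open Embedding E
    ℓ≢p : ℓ ≢ p
    ℓ≢p refl with () ← trans (sym ℓ~p) (irrefl H ℓ)
    kₚ = punchOut ℓ≢p
    open Attachment (attach G realizes f kₚ s+1≤m (initial s+1≤m kₚ)) renaming (realizes to realizes′)
    f′ : Fin (suc (suc s)) → Fin n
    f′ = insertAt f ℓ w
    f′-ℓ : f′ ℓ ≡ w
    f′-ℓ = insertAt-lookup f ℓ w
    f′-punchIn : ∀ k → f′ (punchIn ℓ k) ≡ f k
    f′-punchIn = insertAt-punchIn f ℓ w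
    ℓ-edge : ∀ k → adj H ℓ (punchIn ℓ k) ≡ true → adj G′ (f′ ℓ) (f′ (punchIn ℓ k)) ≡ true
    ℓ-edge k ℓ~k rewrite f′-ℓ | f′-punchIn k
                       | punchIn-injective ℓ k kₚ (trans (only-p _ ℓ~k) (sym (punchIn-punchOut ℓ≢p)))
      = trans (adj-sym G′ w (f kₚ)) x~w
    injective′ : Injective _≡_ _≡_ f′
    injective′ {i} {j} e with ≡-or-punchIn ℓ i | ≡-or-punchIn ℓ j
    ... | inj₁ refl       | inj₁ refl        = refl
    ... | inj₁ refl       | inj₂ (k , refl)  = ⊥-elim (w-new k (trans (sym f′-ℓ) (trans e (f′-punchIn k))))
    ... | inj₂ (k , refl) | inj₁ refl        = ⊥-elim (w-new k (trans (sym f′-ℓ) (trans (sym e) (f′-punchIn k))))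
    ... | inj₂ (k , refl) | inj₂ (k′ , refl) =
      cong (punchIn ℓ) (injective (trans (sym (f′-punchIn k)) (trans e (f′-punchIn k′))))
    preserves′ : ∀ i j → adj H i j ≡ true → adj G′ (f′ i) (f′ j) ≡ true
    preserves′ i j i~j with ≡-or-punchIn ℓ i | ≡-or-punchIn ℓ j
    ... | inj₁ refl       | inj₁ refl        with () ← trans (sym i~j) (irrefl H ℓ)
    ... | inj₁ refl       | inj₂ (k , refl)  = ℓ-edge k i~j
    ... | inj₂ (k , refl) | inj₁ refl        =
      trans (adj-sym G′ _ _) (ℓ-edge k (trans (adj-sym H ℓ _) i~j))
    ... | inj₂ (k , refl) | inj₂ (k′ , refl) rewrite f′-punchIn k | f′-punchIn k′ =
      keeps k k′ (preserves k k′ i~j)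
    initial′ : suc (suc s) ≤ m → ∀ i → toℕ (f′ i) < m
    initial′ s+2≤m i with ≡-or-punchIn ℓ i
    ... | inj₁ refl       rewrite f′-ℓ         = w-initial s+2≤m
    ... | inj₂ (k , refl) rewrite f′-punchIn k = initial s+1≤m k

  single-vertex : (H : Graph 1) → Graphic d → Embedding H
  single-vertex H (G , realizes) = record
    { G = G ; realizes = realizes ; f = λ _ → v₀
    ; injective = λ { {zero} {zero} _ → refl }
    ; preserves = no-loop
    ; initial = λ 1≤m _ → subst (_< m) (sym (toℕ-fromℕ< 0<n)) 1≤m }
    where
    0<n : 0 < n
    0<n = ≤-<-trans z≤n m<n
    v₀ = fromℕ< 0<n
    no-loop : ∀ i j → adj H i j ≡ true → adj G v₀ v₀ ≡ true
    no-loop zero zero 0~0 with () ← trans (sym 0~0) (irrefl H zero)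

  embed-tree : Graphic d → ∀ {s} → s ≤ suc m → (H : Graph s) → IsTree H → Embedding H
  embed-tree _       {zero}        _        H (() , _)
  embed-tree graphic {suc zero}    _        H _ = single-vertex H graphic
  embed-tree graphic {suc (suc s)} s+2≤m+1 H tree =
    let (ℓ , _ , leaf , tree′) = tree-leaf H tree
    in extend H leaf (s≤s⁻¹ s+2≤m+1)
         (embed-tree graphic (≤-trans (n≤1+n _) s+2≤m+1) (deleteVertex H ℓ) tree′)

lemma13 : (t n : ℕ) (T : Graph t) → IsTree T →
    (d : Fin n → ℕ) → NonIncreasing d → Graphic d → t ≤ n →
    (∀ (i : Fin n) → toℕ i ≡ t ∸ 2 → t ∸ 1 ≤ d i) →
    PotentiallyGraphic T d
lemma13 zero    n T (() , _) d _ _ _ _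
lemma13 (suc m) n T tree d nonIncreasing graphic m<n d[t-2]≥t-1 =
  G , realizes , f , injective , preserves
  where
  high : ∀ i → toℕ i < m → m ≤ d i
  high i (s≤s {n = m′} i≤m′) =
    ≤-trans (d[t-2]≥t-1 k (toℕ-fromℕ< m′<n)) (nonIncreasing i k (subst (toℕ i ≤_) (sym (toℕ-fromℕ< m′<n)) i≤m′))
    where
    m′<n : m′ < n
    m′<n = ≤-trans (n≤1+n _) m<n
    k = fromℕ< m′<n
  open TreeEmbedding d nonIncreasing high m<n
  open Embedding (embed-tree graphic ≤-refl T tree)
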